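{- Let $S=\{s_2,s_1\}\subset\mathbb{N}$ with $s_2<s_1$ and $2s_2\le s_1$. Then for every heap size $h\in\mathbb{N}_0$ and every $X,Y\in\tau=\{\mathrm{FvF},\mathrm{FvA},\mathrm{AvF},\mathrm{AvA}\}$, $$o^1_X(h)=o^1_Y(h)\quad\text{and}\quad o^2_X(h)=o^2_Y(h).$$ In particular, the $\mathrm{FvF}$ and $\mathrm{AvA}$ outcomes never differ.
   Context: Self-interest cumulative subtraction game: for a finite set $S\subset\mathbb{N}$, there is one heap of $h\in\mathbb{N}_0$ tokens. Two players alternately remove $s\in S$ tokens (with $s\le h$) and add $s$ to their own score. The game ends when $h<\min S$. Each player maximizes their own final score. In case of indifference, each player follows a fixed deterministic tie-breaking convention: friendly (F), maximizing the opponent's score, or antagonistic (A), minimizing it. In $\tau$, the first letter is the convention of the player to move (player 1) and the second letter is that of the other player (player 2). The dual $\mathsf d$ fixes $\mathrm{FvF}$ and $\mathrm{AvA}$ and swaps $\mathrm{AvF}\leftrightarrow\mathrm{FvA}$. Outcomes are defined recursively for $X\in\tau$ as follows. - If $h<\min S$, then $o^1_X(h)=o^2_X(h)=0$. - Otherwise, let $S(h)=S\cap\{1,\ldots,h\}$ and $o^1_X(h)=\max_{s\in S(h)}\big(s+o^2_{\mathsf d(X)}(h-s)\big)$. Let $S^*(h)$ be the set of maximizers. Then $o^2_X(h)=o^1_{\mathsf d(X)}(h-s^*)$, where $s^*$ minimizes $o^1_{\mathsf d(X)}(h-s)$ over $s\in S^*(h)$ if $X\in\{\mathrm{AvF},\mathrm{AvA}\}$,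 and maximizes it otherwise. -}

module Defs where

open import Data.Nat using (ℕ; zero; suc; _+_; _∸_; _≤_; _<_; _≟_; _≤?_; _⊔_; _⊓_)
open import Data.List using (List; []; _∷_; filter; map; foldr)
open import Data.Product using (_×_; _,_; proj₁; proj₂)
open import Relation.Nullary.Decidable using (_×-dec_)

-- Tie-breaking conventions τ = {FvF, FvA, AvF, AvA};
-- first letter = player to move, second letter = other player.
data Conv : Set where
  FvF FvA AvF AvA : Conv

d : Conv → Conv
d FvF = FvF
d FvA = AvF
d AvF = FvA
d AvA = AvA

maxL : List ℕ → ℕ
maxL = foldr _⊔_ 0

minL : List ℕ → ℕ
minL []       = 0
minL (x ∷ xs) = foldr _⊓_ x xs

moves : List ℕ → ℕ → List ℕ
moves S h = filter (λ s → (1 ≤? s) ×-dec (s ≤? h)) S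

tieBreak : Conv → List ℕ → ℕ
tieBreak AvF = minL
tieBreak AvA = minL
tieBreak FvF = maxL
tieBreak FvA = maxL

-- go f h X = (o¹_X(h) , o²_X(h)), computed with fuel f; correct whenever h < f
-- (every move removes at least 1 token).
go : List ℕ → ℕ → ℕ → Conv → ℕ × ℕ
go S zero    h X = 0 , 0
go S (suc f) h X with moves S h
... | []        = 0 , 0
... | ms@(_ ∷ _) =
  let val : ℕ → ℕ
      val s = s + proj₂ (go S f (h ∸ s) (d X))
      best = maxL (map val ms)
      optimal = filter (λ s → val s ≟ best) ms
  in best , tieBreak X (map (λ s → proj₁ (go S f (h ∸ s) (d X))) optimal)

o¹ : List ℕ → Conv → ℕ → ℕ
o¹ S X h = proj₁ (go S (suc h) h X)

o² : List ℕ → Conv → ℕ → ℕ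
o² S X h = proj₂ (go S (suc h) h X)

-- Greedy play (take s₁ whenever possible, otherwise s₂) is optimal from every heap, in a strong
-- sense: whenever taking s₂ scores as much for the mover as taking s₁, it also leaves the opponent
-- the same score. So the moves tied for the mover always lead to the same pair of scores and no
-- tie-breaking convention can change the outcome. Both facts are checked on the explicit greedy
-- scores: a round of two s₁-moves adds s₁ to both scores and preserves the comparison, which
-- reduces it to positions with at most one s₁-move left, where 2·s₂ ≤ s₁ is what is needed.
module Submission where

open import Defs
open import Data.Nat
open import Data.Nat.Properties
open import Data.Nat.DivMod using (_/_; _%_; m%n<n; m≡m%n+[m/n]*n)
open import Data.List using (List; []; _∷_; filter; map)
open import Data.List.Properties using (filter-accept; filter-reject)
open import Data.Product using (_×_; _,_; proj₁; proj₂; ∃; ∃₂)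
open import Data.Sum using (_⊎_; inj₁; inj₂)
open import Data.Empty using (⊥-elim)
open import Relation.Nullary.Decidable using (_×-dec_)
open import Relation.Unary using (Decidable)
open import Function using (_∘_)
open import Relation.Binary.PropositionalEquality
open import Algebra.Properties.CommutativeSemigroup +-commutativeSemigroup using (x∙yz≈y∙xz)
open ≡-Reasoning

m≡n+o⇒m∸n≡o : ∀ {m} n {o} → m ≡ n + o → m ∸ n ≡ o
m≡n+o⇒m∸n≡o n {o} refl = m+n∸m≡n n o

m<1+o⇒m∸n<o : ∀ {m n o} → 0 < n → n ≤ m → m < suc o → m ∸ n < o
m<1+o⇒m∸n<o 0<n n≤m m<1+o = <-≤-trans (∸-monoʳ-< 0<n n≤m) (≤-pred m<1+o)

infixr 5 _▷_
infix 4 _⊑_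

_▷_ : ℕ → ℕ × ℕ → ℕ × ℕ
s ▷ p = s + proj₂ p , proj₁ p

-- A mover choosing between the outcome pairs p and q picks q under every tie-breaking convention.
_⊑_ : ℕ × ℕ → ℕ × ℕ → Set
p ⊑ q = proj₁ p < proj₁ q ⊎ p ≡ q

-- t ▷ t ▷ p reduces to raise t p.
raise : ℕ → ℕ × ℕ → ℕ × ℕ
raise n p = n + proj₁ p , n + proj₂ p

▷-raise : ∀ s t p → s ▷ raise t p ≡ raise t (s ▷ p)
▷-raise s t p = cong (_, t + proj₁ p) (x∙yz≈y∙xz s t (proj₂ p))

raise-mono-⊑ : ∀ n {p q} → p ⊑ q → raise n p ⊑ raise n q
raise-mono-⊑ n (inj₁ lt) = inj₁ (+-monoʳ-< n lt)
raise-mono-⊑ n (inj₂ eq) = inj₂ (cong (raise n) eq)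

⊑-round : ∀ {s t} u p q → s ▷ p ⊑ t ▷ q → s ▷ raise u p ⊑ t ▷ raise u q
⊑-round {s} {t} u p q pref =
  subst₂ _⊑_ (sym (▷-raise s u p)) (sym (▷-raise t u q)) (raise-mono-⊑ u pref)

choose : Conv → (ℕ → ℕ × ℕ) → List ℕ → ℕ × ℕ
choose X r ms = best , tieBreak X (map (proj₂ ∘ r) (filter (λ s → proj₁ (r s) ≟ best) ms))
  where best = maxL (map (proj₁ ∘ r) ms)

go-stuck : ∀ {S f h X} → moves S h ≡ [] → go S (suc f) h X ≡ (0 , 0)
go-stuck eq rewrite eq = refl

go-step : ∀ {S f h X m ms} → moves S h ≡ m ∷ ms →
  go S (suc f) h X ≡ choose X (λ s → s ▷ go S f (h ∸ s) (d X)) (m ∷ ms)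
go-step eq rewrite eq = refl

tieBreak-single : ∀ X u → tieBreak X (u ∷ []) ≡ u
tieBreak-single FvF u = ⊔-identityʳ u
tieBreak-single FvA u = ⊔-identityʳ u
tieBreak-single AvF u = refl
tieBreak-single AvA u = refl

tieBreak-twice : ∀ X u → tieBreak X (u ∷ u ∷ []) ≡ u
tieBreak-twice FvF u = trans (cong (u ⊔_) (⊔-identityʳ u)) (⊔-idem u)
tieBreak-twice FvA u = trans (cong (u ⊔_) (⊔-identityʳ u)) (⊔-idem u)
tieBreak-twice AvF u = ⊓-idem u
tieBreak-twice AvA u = ⊓-idem u

module _ (X : Conv) (r : ℕ → ℕ × ℕ) where
  private
    v g : ℕ → ℕ
    v = proj₁ ∘ r
    g = proj₂ ∘ r

    max-pair : ∀ {s t} → v s ≤ v t → v s ⊔ (v t ⊔ 0) ≡ v t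
    max-pair {s} {t} vs≤vt = trans (cong (v s ⊔_) (⊔-identityʳ (v t))) (m≤n⇒m⊔n≡n vs≤vt)

  choose-single : ∀ s → choose X r (s ∷ []) ≡ r s
  choose-single s = cong₂ _,_ (⊔-identityʳ (v s)) (begin
      tieBreak X (map g (filter optimal? (s ∷ [])))
    ≡⟨ cong (tieBreak X ∘ map g) (filter-accept optimal? (sym (⊔-identityʳ (v s)))) ⟩
      tieBreak X (g s ∷ [])
    ≡⟨ tieBreak-single X (g s) ⟩
      g s ∎)
    where optimal? = λ x → v x ≟ v s ⊔ 0

  choose-preferred : ∀ s t → r s ⊑ r t → choose X r (s ∷ t ∷ []) ≡ r t
  choose-preferred s t (inj₁ vs<vt) = cong₂ _,_ best≡vt (begin
      tieBreak X (map g (filter optimal? (s ∷ t ∷ [])))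
    ≡⟨ cong (tieBreak X ∘ map g) (trans (filter-reject optimal? (<⇒≢ vs<vt ∘ (λ e → trans e best≡vt)))
                                        (filter-accept optimal? (sym best≡vt))) ⟩
      tieBreak X (g t ∷ [])
    ≡⟨ tieBreak-single X (g t) ⟩
      g t ∎)
    where
    best≡vt = max-pair (<⇒≤ vs<vt)
    optimal? = λ x → v x ≟ v s ⊔ (v t ⊔ 0)
  choose-preferred s t (inj₂ rs≡rt) = cong₂ _,_ best≡vt (begin
      tieBreak X (map g (filter optimal? (s ∷ t ∷ [])))
    ≡⟨ cong (tieBreak X ∘ map g) (trans (filter-accept optimal? (trans (cong proj₁ rs≡rt) (sym best≡vt)))
                                        (cong (s ∷_) (filter-accept optimal? (sym best≡vt)))) ⟩
      tieBreak X (g s ∷ g t ∷ [])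
    ≡⟨ cong (λ u → tieBreak X (u ∷ g t ∷ [])) (cong proj₂ rs≡rt) ⟩
      tieBreak X (g t ∷ g t ∷ [])
    ≡⟨ tieBreak-twice X (g t) ⟩
      g t ∎)
    where
    best≡vt = max-pair (≤-reflexive (cong proj₁ rs≡rt))
    optimal? = λ x → v x ≟ v s ⊔ (v t ⊔ 0)

go-forced : ∀ {S f h X s} → moves S h ≡ s ∷ [] → go S (suc f) h X ≡ s ▷ go S f (h ∸ s) (d X)
go-forced {S} {f} {h} {X} {s} eq = trans (go-step eq) (choose-single X (λ t → t ▷ go S f (h ∸ t) (d X)) s)

go-preferred : ∀ {S f h X s t} → moves S h ≡ s ∷ t ∷ [] →
  s ▷ go S f (h ∸ s) (d X) ⊑ t ▷ go S f (h ∸ t) (d X) → go S (suc f) h X ≡ t ▷ go S f (h ∸ t) (d X)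
go-preferred {S} {f} {h} {X} {s} {t} eq pref =
  trans (go-step eq) (choose-preferred X (λ u → u ▷ go S f (h ∸ u) (d X)) s t pref)

module TwoMoves (a b : ℕ) (0<a : 0 < a) (a<b : a < b) (2a≤b : 2 * a ≤ b) where

  S : List ℕ
  S = a ∷ b ∷ []

  a≤b : a ≤ b
  a≤b = <⇒≤ a<b

  0<b : 0 < b
  0<b = <-trans 0<a a<b

  instance
    a≢0 : NonZero a
    a≢0 = >-nonZero 0<a
    b≢0 : NonZero b
    b≢0 = >-nonZero 0<b

  greedy : ℕ → ℕ → ℕ × ℕ
  greedy zero    zero    = 0 , 0
  greedy zero    (suc j) = a ▷ greedy zero j
  greedy (suc k) j       = b ▷ greedy k j

  greedy₀-proj₁-≤ : ∀ j → proj₁ (greedy 0 j) ≤ j * a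
  greedy₀-proj₁-≤ zero          = z≤n
  greedy₀-proj₁-≤ (suc zero)    = ≤-refl
  greedy₀-proj₁-≤ (suc (suc j)) = +-monoʳ-≤ a (≤-trans (greedy₀-proj₁-≤ j) (m≤n+m (j * a) a))

  b-over-a : ∀ k j → a ▷ greedy (suc k) j ⊑ b ▷ greedy k (suc j)
  b-over-a zero          j = inj₁ (+-monoˡ-< (proj₁ (greedy 0 j)) a<b)
  b-over-a (suc zero)    j = inj₂ (▷-raise a b (greedy 0 j))
  b-over-a (suc (suc k)) j =
    ⊑-round b (greedy (suc k) j) (greedy k (suc j)) (b-over-a k j)

  b-over-a-borrow : ∀ k j → suc j * a < b → a ▷ greedy k (suc j) ⊑ b ▷ greedy k 0
  b-over-a-borrow zero j ja<b =
    inj₁ (<-≤-trans (≤-<-trans (+-monoʳ-≤ a (greedy₀-proj₁-≤ j)) ja<b) (m≤m+n b 0))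
  b-over-a-borrow (suc zero) zero _ with m≤n⇒m<n∨m≡n 2a≤b
  ... | inj₁ 2a<b = inj₁ (<-≤-trans 2a<b (m≤m+n b 0))
  ... | inj₂ 2a≡b = inj₂ (cong (_, b + 0) (trans 2a≡b (sym (+-identityʳ b))))
  b-over-a-borrow (suc zero) (suc j) ja<b =
    inj₁ (<-≤-trans (≤-<-trans (+-monoʳ-≤ a (+-monoʳ-≤ a (greedy₀-proj₁-≤ j))) ja<b) (m≤m+n b 0))
  b-over-a-borrow (suc (suc k)) j ja<b =
    ⊑-round b (greedy k (suc j)) (greedy k 0) (b-over-a-borrow k j ja<b)

  -- h = k·b + j·a + rest: greedy play from h takes b k times, then a j times, leaving rest.
  record Greedy (h k j : ℕ) : Set where
    constructor split
    field
      rest    : ℕ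
      rest<a  : rest < a
      below-b : j * a + rest < b
      h≡      : h ≡ k * b + (j * a + rest)

  Greedy-b : ∀ {h k j} → Greedy h (suc k) j → Greedy (h ∸ b) k j
  Greedy-b {k = k} (split e e<a below h≡) =
    split e e<a below (m≡n+o⇒m∸n≡o b (trans h≡ (+-assoc b (k * b) _)))

  Greedy-a : ∀ {h k j} → Greedy h k (suc j) → Greedy (h ∸ a) k j
  Greedy-a {h} {k} {j} (split e e<a below h≡) = split e e<a below′ (m≡n+o⇒m∸n≡o a h≡′)
    where
    below′ : j * a + e < b
    below′ = ≤-<-trans (m≤n+m (j * a + e) a) (subst (_< b) (+-assoc a (j * a) e) below)
    h≡′ : h ≡ a + (k * b + (j * a + e))
    h≡′ = begin
      h                           ≡⟨ h≡ ⟩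
      k * b + ((a + j * a) + e)   ≡⟨ cong (k * b +_) (+-assoc a (j * a) e) ⟩
      k * b + (a + (j * a + e))   ≡⟨ x∙yz≈y∙xz (k * b) a (j * a + e) ⟩
      a + (k * b + (j * a + e))   ∎

  Greedy-+b : ∀ {n j} k → Greedy n 0 j → Greedy (k * b + n) k j
  Greedy-+b k (split e e<a below h≡) = split e e<a below (cong (k * b +_) h≡)

  Greedy-exists-below-b : ∀ {n} → n < b → ∃ λ j → Greedy n 0 j
  Greedy-exists-below-b {n} n<b = n / a , split (n % a) (m%n<n n a) (subst (_< b) n≡ n<b) n≡
    where
    n≡ : n ≡ n / a * a + n % a
    n≡ = trans (m≡m%n+[m/n]*n n a) (+-comm (n % a) _)

  Greedy-exists : ∀ h → ∃₂ λ k j → Greedy h k j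
  Greedy-exists h with Greedy-exists-below-b (m%n<n h b)
  ... | j , g = h / b , j , subst (λ n → Greedy n (h / b) j) (sym h≡) (Greedy-+b (h / b) g)
    where
    h≡ : h ≡ h / b * b + h % b
    h≡ = trans (m≡m%n+[m/n]*n h b) (+-comm (h % b) _)

  a≤b∸a : a ≤ b ∸ a
  a≤b∸a = m+n≤o⇒m≤o∸n a (subst (_≤ b) (cong (a +_) (+-identityʳ a)) 2a≤b)

  b∸a+e<b : ∀ {e} → e < a → b ∸ a + e < b
  b∸a+e<b {e} e<a = subst (b ∸ a + e <_) (m∸n+n≡m a≤b) (+-monoʳ-< (b ∸ a) e<a)

  -- Taking a from k·b + b + rest borrows a b: the new remainder b ∸ a + rest needs an a-move.
  Greedy-borrow : ∀ {h k} → Greedy h (suc k) 0 → ∃ λ j → Greedy (h ∸ a) k (suc j)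
  Greedy-borrow {h} {k} (split e e<a _ h≡) with Greedy-exists-below-b (b∸a+e<b e<a)
  ... | zero , split e′ e′<a _ n≡e′ =
    ⊥-elim (<⇒≱ e′<a (≤-trans a≤b∸a (≤-trans (m≤m+n (b ∸ a) e) (≤-reflexive n≡e′))))
  ... | suc j , g = j , subst (λ m → Greedy m k (suc j)) (sym h∸a≡) (Greedy-+b k g)
    where
    h∸a≡ : h ∸ a ≡ k * b + (b ∸ a + e)
    h∸a≡ = m≡n+o⇒m∸n≡o a (begin
      h                              ≡⟨ h≡ ⟩
      (b + k * b) + e                ≡⟨ +-assoc b (k * b) e ⟩
      b + (k * b + e)                ≡⟨ cong (_+ (k * b + e)) (sym (m+[n∸m]≡n a≤b)) ⟩
      (a + (b ∸ a)) + (k * b + e)    ≡⟨ +-assoc a (b ∸ a) (k * b + e) ⟩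
      a + ((b ∸ a) + (k * b + e))    ≡⟨ cong (a +_) (x∙yz≈y∙xz (b ∸ a) (k * b) e) ⟩
      a + (k * b + (b ∸ a + e))      ∎)

  Greedy⇒j*a<b : ∀ {h k j} → Greedy h k j → j * a < b
  Greedy⇒j*a<b (split e _ below _) = ≤-<-trans (m≤m+n _ e) below

  b-preferred : ∀ {h k j} → Greedy h (suc k) j →
    ∃₂ λ k′ j′ → Greedy (h ∸ a) k′ j′ × a ▷ greedy k′ j′ ⊑ b ▷ greedy k j
  b-preferred {k = k} {suc j} g = suc k , j , Greedy-a g , b-over-a k j
  b-preferred {k = k} {zero}  g with Greedy-borrow g
  ... | j , g′ = k , suc j , g′ , b-over-a-borrow k j (Greedy⇒j*a<b g′)

  Greedy⇒h<a : ∀ {h} → Greedy h 0 0 → h < a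
  Greedy⇒h<a (split _ e<a _ h≡) = subst (_< a) (sym h≡) e<a

  Greedy⇒h<b : ∀ {h j} → Greedy h 0 j → h < b
  Greedy⇒h<b (split _ _ below h≡) = subst (_< b) (sym h≡) below

  Greedy⇒a≤h : ∀ {h j} → Greedy h 0 (suc j) → a ≤ h
  Greedy⇒a≤h {j = j} (split e _ _ h≡) =
    ≤-trans (≤-trans (m≤m+n a (j * a)) (m≤m+n _ e)) (≤-reflexive (sym h≡))

  Greedy⇒b≤h : ∀ {h k j} → Greedy h (suc k) j → b ≤ h
  Greedy⇒b≤h {k = k} (split _ _ _ h≡) =
    ≤-trans (≤-trans (m≤m+n b (k * b)) (m≤m+n _ _)) (≤-reflexive (sym h≡))

  private
    legal? : ∀ h → Decidable (λ s → 1 ≤ s × s ≤ h)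
    legal? h s = (1 ≤? s) ×-dec (s ≤? h)

  moves-none : ∀ {h} → h < a → moves S h ≡ []
  moves-none {h} h<a = trans (filter-reject (legal? h) (<⇒≱ h<a ∘ proj₂))
                             (filter-reject (legal? h) (<⇒≱ (<-trans h<a a<b) ∘ proj₂))

  moves-single : ∀ {h} → a ≤ h → h < b → moves S h ≡ a ∷ []
  moves-single {h} a≤h h<b = trans (filter-accept (legal? h) (0<a , a≤h))
                                   (cong (a ∷_) (filter-reject (legal? h) (<⇒≱ h<b ∘ proj₂)))

  moves-both : ∀ {h} → b ≤ h → moves S h ≡ a ∷ b ∷ []
  moves-both {h} b≤h = trans (filter-accept (legal? h) (0<a , ≤-trans a≤b b≤h))
                             (cong (a ∷_) (filter-accept (legal? h) (0<b , b≤h)))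

  go-greedy : ∀ f X {h k j} → Greedy h k j → h < f → go S f h X ≡ greedy k j
  go-greedy (suc f) X {k = zero} {zero} g _ = go-stuck (moves-none (Greedy⇒h<a g))
  go-greedy (suc f) X {h} {zero} {suc j} g h<1+f = begin
      go S (suc f) h X          ≡⟨ go-forced (moves-single a≤h (Greedy⇒h<b g)) ⟩
      a ▷ go S f (h ∸ a) (d X)  ≡⟨ cong (a ▷_) IHa ⟩
      a ▷ greedy 0 j            ∎
    where
    a≤h = Greedy⇒a≤h g
    IHa = go-greedy f (d X) (Greedy-a g) (m<1+o⇒m∸n<o 0<a a≤h h<1+f)
  go-greedy (suc f) X {h} {suc k} {j} g h<1+f with b-preferred g
  ... | k′ , j′ , g′ , pref = begin
      go S (suc f) h X          ≡⟨ go-preferred (moves-both b≤h) pref′ ⟩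
      b ▷ go S f (h ∸ b) (d X)  ≡⟨ cong (b ▷_) IHb ⟩
      b ▷ greedy k j            ∎
    where
    b≤h = Greedy⇒b≤h g
    IHa = go-greedy f (d X) g′ (m<1+o⇒m∸n<o 0<a (≤-trans a≤b b≤h) h<1+f)
    IHb = go-greedy f (d X) (Greedy-b g) (m<1+o⇒m∸n<o 0<b b≤h h<1+f)
    pref′ : a ▷ go S f (h ∸ a) (d X) ⊑ b ▷ go S f (h ∸ b) (d X)
    pref′ = subst₂ (λ p q → a ▷ p ⊑ b ▷ q) (sym IHa) (sym IHb) pref

  go-convention-free : ∀ h X Y → go S (suc h) h X ≡ go S (suc h) h Y
  go-convention-free h X Y with Greedy-exists h
  ... | k , j , g = trans (go-greedy (suc h) X g ≤-refl) (sym (go-greedy (suc h) Y g ≤-refl))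

proposition1 : (s₂ s₁ : ℕ) → 0 < s₂ → s₂ < s₁ → 2 * s₂ ≤ s₁ →
    (h : ℕ) (X Y : Conv) →
    (o¹ (s₂ ∷ s₁ ∷ []) X h ≡ o¹ (s₂ ∷ s₁ ∷ []) Y h)
      × (o² (s₂ ∷ s₁ ∷ []) X h ≡ o² (s₂ ∷ s₁ ∷ []) Y h)
proposition1 s₂ s₁ 0<s₂ s₂<s₁ 2s₂≤s₁ h X Y = cong proj₁ X≡Y , cong proj₂ X≡Y
  where X≡Y = TwoMoves.go-convention-free s₂ s₁ 0<s₂ s₂<s₁ 2s₂≤s₁ h X Y
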